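{- Let $\mathbf P=(P,\leq)$ be a poset and $S,T$ tolerances on $\mathbf P$ with $S\leq T$, and assume that the relation $T/S$ on the poset $\mathbf P/S=(P/S,\sqsubseteq)$ satisfies conditions (1)–(4) (with respect to the order $\sqsubseteq$ of $\mathbf P/S$). Then (i) $T/S$ is a tolerance on $\mathbf P/S$; (ii) $|(P/S)/(T/S)|\geq|P/T|$, where $(P/S)/(T/S)$ is the set of blocks of $T/S$.
   Context: For a poset $\mathbf Q=(Q,\leq)$ and $x,y\in Q$, $x\vee y$ and $x\wedge y$ denote the supremum and infimum of $\{x,y\}$ in $\mathbf Q$ (when they exist). For a binary relation $T$ on $Q$ consider the conditions: (1) if $(x,y),(z,u)\in T$ and $x\vee z$ and $y\vee u$ exist then $(x\vee z,y\vee u)\in T$; (2) if $(x,y),(z,u)\in T$ and $x\wedge z$ and $y\wedge u$ exist then $(x\wedge z,y\wedge u)\in T$; (3) if $x,y,z\in Q$, $(x,y),(y,z)\in T$ and $T\neq Q^2$, then there exist $u,v\in Q$ with $u\leq x,y,z\leq v$ and $(u,y),(y,v)\in T$; (4) if $(x,y)\in T$ and $T\neq Q^2$, then there exists some $(z,u)\in T$ with $z\leq x,y\leq u$ and such that $(v,z),(v,u)\in T$ for all $v\in Q$ with $(v,x),(v,y)\in T$. A tolerance on $\mathbf Q$ is a reflexive and symmetric binary relation on $Q$ satisfying (1)–(4). A block of a tolerance $T$ is a maximal subset $B\subseteq Q$ with $B^2\subseteq T$; $Q/T$ is the set of blocks. For blocks $B_1,B_2$ define $B_1\sqsubseteq B_2$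 iff for every $b_1\in B_1$ there exists $b_2'\in B_2$ with $b_1\leq b_2'$, and for every $b_2\in B_2$ there exists $b_1'\in B_1$ with $b_1'\leq b_2$; $(Q/T,\sqsubseteq)$ is a poset, denoted $\mathbf Q/T$. For tolerances $S,T$ on $\mathbf P$, $S\leq T$ means: for every $B_1\in P/S$ there is exactly one $B_2\in P/T$ with $B_1\subseteq B_2$, and every block of $T$ is a union of blocks of $S$. In that case $T/S$ is the binary relation on $P/S$ given by $(B_1,B_2)\in T/S$ iff there exists $B_3\in P/T$ with $B_1,B_2\subseteq B_3$. -}

module Defs where

open import Level using (Level; _⊔_; suc; 0ℓ)
open import Relation.Binary using (Rel; Reflexive; Symmetric; IsPartialOrder)
open import Relation.Binary.PropositionalEquality using (_≡_)
open import Relation.Unary using (Pred; _⊆_; _∈_; _≐_)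
open import Data.Product using (Σ; ∃; ∃₂; _×_; _,_; proj₁; proj₂)
open import Relation.Nullary using (¬_)

module _ {a ℓ : Level} {A : Set a} (_≤_ : Rel A ℓ) where

  IsSup : A → A → A → Set (a ⊔ ℓ)
  IsSup x y s = x ≤ s × y ≤ s × (∀ w → x ≤ w → y ≤ w → s ≤ w)

  IsInf : A → A → A → Set (a ⊔ ℓ)
  IsInf x y s = s ≤ x × s ≤ y × (∀ w → w ≤ x → w ≤ y → w ≤ s)

  module _ {t : Level} (T : Rel A t) where

    Full : Set (a ⊔ t)
    Full = ∀ x y → T x y

    Cond1 : Set (a ⊔ ℓ ⊔ t)
    Cond1 = ∀ {x y z u s r} → T x y → T z u → IsSup x z s → IsSup y u r → T s r

    Cond2 : Set (a ⊔ ℓ ⊔ t)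
    Cond2 = ∀ {x y z u s r} → T x y → T z u → IsInf x z s → IsInf y u r → T s r

    Cond3 : Set (a ⊔ ℓ ⊔ t)
    Cond3 = ∀ {x y z} → T x y → T y z → ¬ Full →
            ∃₂ λ u v → (u ≤ x × u ≤ y × u ≤ z) × (x ≤ v × y ≤ v × z ≤ v)
                       × T u y × T y v

    Cond4 : Set (a ⊔ ℓ ⊔ t)
    Cond4 = ∀ {x y} → T x y → ¬ Full →
            ∃₂ λ z u → T z u × (z ≤ x × z ≤ y) × (x ≤ u × y ≤ u)
                       × (∀ v → T v x → T v y → T v z × T v u)

    Conds1-4 : Set (a ⊔ ℓ ⊔ t)
    Conds1-4 = Cond1 × Cond2 × Cond3 × Cond4

    IsTolerance : Set (a ⊔ ℓ ⊔ t)
    IsTolerance = Reflexive T × Symmetric T × Conds1-4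

module _ {a t : Level} {A : Set a} (T : Rel A t) where

  Sq⊆ : Pred A (a ⊔ t) → Set (a ⊔ t)
  Sq⊆ B = ∀ {x y} → x ∈ B → y ∈ B → T x y

  IsBlock : Pred A (a ⊔ t) → Set (suc (a ⊔ t))
  IsBlock B = Sq⊆ B × (∀ (C : Pred A (a ⊔ t)) → B ⊆ C → Sq⊆ C → C ⊆ B)

  Block : Set (suc (a ⊔ t))
  Block = Σ (Pred A (a ⊔ t)) IsBlock

module _ {a ℓ t : Level} {A : Set a} (_≤_ : Rel A ℓ) (T : Rel A t) where

  _⊑_ : Rel (Block T) (a ⊔ ℓ ⊔ t)
  (B₁ , _) ⊑ (B₂ , _) =
    (∀ b₁ → b₁ ∈ B₁ → ∃ λ b₂ → b₂ ∈ B₂ × b₁ ≤ b₂) ×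
    (∀ b₂ → b₂ ∈ B₂ → ∃ λ b₁ → b₁ ∈ B₁ × b₁ ≤ b₂)

module _ {a t : Level} {A : Set a} (S T : Rel A t) where

  _≤Tol_ : Set (suc (a ⊔ t))
  _≤Tol_ =
    (∀ (B₁ : Block S) → ∃ λ (B₂ : Block T) → proj₁ B₁ ⊆ proj₁ B₂ ×
         (∀ (B₂′ : Block T) → proj₁ B₁ ⊆ proj₁ B₂′ → proj₁ B₂′ ≐ proj₁ B₂)) ×
    (∀ (B₂ : Block T) → ∀ x → x ∈ proj₁ B₂ →
         ∃ λ (B₁ : Block S) → x ∈ proj₁ B₁ × proj₁ B₁ ⊆ proj₁ B₂)

  _/Tol_ : Rel (Block S) (suc (a ⊔ t))
  _/Tol_ B₁ B₂ = ∃ λ (B₃ : Block T) → proj₁ B₁ ⊆ proj₁ B₃ × proj₁ B₂ ⊆ proj₁ B₃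

{-# OPTIONS --safe #-}
module Submission where

open import Defs
open import Level using (Level; 0ℓ; _⊔_; Lift; lift; lower)
import Level
open import Relation.Binary using (Rel; IsPartialOrder; Reflexive; Symmetric)
open import Relation.Binary.PropositionalEquality using (_≡_; refl)
open import Relation.Unary using (Pred; _⊆_; _∈_; _≐_; _∪_; ｛_｝)
open import Data.Product using (∃; _×_; proj₁; proj₂; _,_)
open import Data.Sum using (inj₁; inj₂)

-- The map B ↦ {S-blocks contained in B} sends T-blocks to blocks of T/S.
-- It is a block because a T-block already contains every point T-related
-- to all of it; it is injective because a T-block is the union of the
-- S-blocks it contains.

module _ {a t : Level} {A : Set a} {T : Rel A t}
         (reflT : Reflexive T) (symT : Symmetric T) where

  Sq⊆-∪-｛｝ : ∀ {B : Pred A (a ⊔ t)} {x} → Sq⊆ T B →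
              (∀ {z} → z ∈ B → T z x) → Sq⊆ T (B ∪ ｛ x ｝)
  Sq⊆-∪-｛｝ sqB _    (inj₁ y∈B) (inj₁ z∈B) = sqB y∈B z∈B
  Sq⊆-∪-｛｝ _   B~x  (inj₁ y∈B) (inj₂ refl) = B~x y∈B
  Sq⊆-∪-｛｝ _   B~x  (inj₂ refl) (inj₁ z∈B) = symT (B~x z∈B)
  Sq⊆-∪-｛｝ _   _    (inj₂ refl) (inj₂ refl) = reflT

  block-absorbs : ∀ ((B , _) : Block T) {x} → (∀ {z} → z ∈ B → T z x) → x ∈ B
  block-absorbs (B , sqB , maximal) B~x =
    maximal (B ∪ ｛ _ ｝) inj₁ (Sq⊆-∪-｛｝ sqB B~x) (inj₂ refl)

module _ {a t : Level} {A : Set a} (S : Rel A t) where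

  IsUnionOfBlocks : Pred A (a ⊔ t) → Set (Level.suc (a ⊔ t))
  IsUnionOfBlocks B = ∀ x → x ∈ B → ∃ λ (B₁ : Block S) → x ∈ proj₁ B₁ × proj₁ B₁ ⊆ B

  blocksIn : Pred A (a ⊔ t) → Pred (Block S) (Level.suc (a ⊔ t))
  blocksIn B B₁ = Lift _ (proj₁ B₁ ⊆ B)

  blocksIn-mono : ∀ {B B′} → B ⊆ B′ → blocksIn B ⊆ blocksIn B′
  blocksIn-mono B⊆B′ {B₁} (lift B₁⊆B) = lift (λ x∈B₁ → B⊆B′ (B₁⊆B x∈B₁))

  blocksIn-reflects-⊆ : ∀ {B B′} → IsUnionOfBlocks B → blocksIn B ⊆ blocksIn B′ → B ⊆ B′
  blocksIn-reflects-⊆ union below {x} x∈B =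
    let (B₁ , x∈B₁ , B₁⊆B) = union x x∈B in lower (below {B₁} (lift B₁⊆B)) x∈B₁

  blocksIn-cong : ∀ {B B′} → B ≐ B′ → blocksIn B ≐ blocksIn B′
  blocksIn-cong (B⊆B′ , B′⊆B) =
    (λ {B₁} → blocksIn-mono B⊆B′ {B₁}) , (λ {B₁} → blocksIn-mono B′⊆B {B₁})

  blocksIn-injective : ∀ {B B′} → IsUnionOfBlocks B → IsUnionOfBlocks B′ →
                       blocksIn B ≐ blocksIn B′ → B ≐ B′
  blocksIn-injective {B} {B′} union union′ (below , below′) =
    (λ {x} → blocksIn-reflects-⊆ {B} {B′} union (λ {B₁} → below {B₁}) {x}) ,
    (λ {x} → blocksIn-reflects-⊆ {B′} {B} union′ (λ {B₁} → below′ {B₁}) {x})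

module _ {a t : Level} {A : Set a} (S T : Rel A t) where

  /Tol-reflexive : (∀ (B₁ : Block S) → ∃ λ (B₂ : Block T) → proj₁ B₁ ⊆ proj₁ B₂) →
                   Reflexive (_/Tol_ S T)
  /Tol-reflexive covered {B₁} = let (B₂ , B₁⊆B₂) = covered B₁ in B₂ , B₁⊆B₂ , B₁⊆B₂

  /Tol-symmetric : Symmetric (_/Tol_ S T)
  /Tol-symmetric (B₃ , B₁⊆B₃ , B₂⊆B₃) = B₃ , B₂⊆B₃ , B₁⊆B₃

  blocksIn-isBlock : Reflexive T → Symmetric T → ∀ (B : Block T) →
                     IsUnionOfBlocks S (proj₁ B) → IsBlock (_/Tol_ S T) (blocksIn S (proj₁ B))
  blocksIn-isBlock reflT symT B union = (λ {B₁ B₂} → sq {B₁} {B₂}) , maximal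
    where
    sq : Sq⊆ (_/Tol_ S T) (blocksIn S (proj₁ B))
    sq {B₁} {B₂} (lift B₁⊆B) (lift B₂⊆B) = B , B₁⊆B , B₂⊆B

    maximal : ∀ C → blocksIn S (proj₁ B) ⊆ C → Sq⊆ (_/Tol_ S T) C → C ⊆ blocksIn S (proj₁ B)
    maximal C below sqC {B₁} B₁∈C = lift (λ x∈B₁ → block-absorbs reflT symT B (B~x x∈B₁))
      where
      B~x : ∀ {x z} → x ∈ proj₁ B₁ → z ∈ proj₁ B → T z x
      B~x {z = z} x∈B₁ z∈B =
        let (Bz , z∈Bz , Bz⊆B) = union z z∈B
            (B₃ , Bz⊆B₃ , B₁⊆B₃) = sqC (below {Bz} (lift Bz⊆B)) B₁∈C
        in proj₁ (proj₂ B₃) (Bz⊆B₃ z∈Bz) (B₁⊆B₃ x∈B₁)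

theorem6 : (P : Set) (_≤_ : Rel P 0ℓ) → IsPartialOrder _≡_ _≤_ →
           (S T : Rel P 0ℓ) → IsTolerance _≤_ S → IsTolerance _≤_ T →
           _≤Tol_ S T →
           Conds1-4 (_⊑_ _≤_ S) (_/Tol_ S T) →
           IsTolerance (_⊑_ _≤_ S) (_/Tol_ S T)
           × (∃ λ (f : Block T → Block (_/Tol_ S T)) →
                (∀ B B′ → proj₁ B ≐ proj₁ B′ → proj₁ (f B) ≐ proj₁ (f B′))
                × (∀ B B′ → proj₁ (f B) ≐ proj₁ (f B′) → proj₁ B ≐ proj₁ B′))
theorem6 _ _ _ S T _ (reflT , symT , _) (unique , union) conds =
  ((λ {B} → reflexive {B}) , (λ {B₁ B₂} → /Tol-symmetric S T {B₁} {B₂}) , conds) ,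
  f , respects , injective
  where
  reflexive : Reflexive (_/Tol_ S T)
  reflexive {B₁} = /Tol-reflexive S T (λ B → proj₁ (unique B) , proj₁ (proj₂ (unique B))) {B₁}

  f : Block T → Block (_/Tol_ S T)
  f B = blocksIn S (proj₁ B) , blocksIn-isBlock S T reflT symT B (union B)

  respects : ∀ B B′ → proj₁ B ≐ proj₁ B′ → proj₁ (f B) ≐ proj₁ (f B′)
  respects _ _ = blocksIn-cong S

  injective : ∀ B B′ → proj₁ (f B) ≐ proj₁ (f B′) → proj₁ B ≐ proj₁ B′
  injective B B′ = blocksIn-injective S (union B) (union B′)
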